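{- Let $q\equiv 3\pmod 4$ be a prime power and let $S\subset\mathbb{F}_q^2$. If $|S|\gg q^{5/3}$, then the number of rectangles with vertices in $S$ and non-zero side-lengths is at least $\gg |S|^4/q^3$.
   Context: Four points of $\mathbb{F}_q^2$ in cyclic order $u_1,u_2,u_3,u_4$ form a rectangle if $(u_{i-1}-u_i)\cdot(u_{i+1}-u_i)=0$ for every $i$ (indices mod 4); the side-length of a side $uv$ is $(u-v)\cdot(u-v)$. Rectangles are counted as ordered quadruples of vertices. The notation $U\gg V$ means $U\ge cV$ for an absolute constant $c>0$; the hypothesis $|S|\gg q^{5/3}$ means $|S|\ge Cq^{5/3}$ for a sufficiently large absolute constant $C$. -}

module Defs where

open import Data.Nat using (ℕ; suc; _^_; _≥_)
open import Data.Nat.Primality using (Prime)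
open import Data.Fin using (Fin)
open import Data.Fin.Properties using () renaming (_≟_ to _≟ᶠ_)
open import Data.Bool using (Bool; true; false)
import Data.Bool
open import Data.List using (List; allFin; cartesianProduct; filter; length; map)
open import Data.Product using (_×_; _,_; ∃; ∃-syntax)
open import Relation.Binary.PropositionalEquality using (_≡_; _≢_)
open import Relation.Nullary using (Dec; yes; no; ¬_)
open import Relation.Nullary.Decidable using (_×-dec_; ¬?)
open import Algebra.Structures using (IsCommutativeRing)

IsPrimePower : ℕ → Set
IsPrimePower q = ∃[ p ] ∃[ k ] (Prime p × k ≥ 1 × q ≡ p ^ k)

-- A field structure on the finite set Fin q (every finite field of order q
-- is isomorphic to one of these), with propositional equality.
record FiniteField (q : ℕ) : Set where
  field
    _+_ _*_ : Fin q → Fin q → Fin q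
    -_      : Fin q → Fin q
    0# 1#   : Fin q
    isCommutativeRing : IsCommutativeRing _≡_ _+_ _*_ -_ 0# 1#
    0≢1     : 0# ≢ 1#
    inverse : ∀ x → x ≢ 0# → ∃[ y ] (x * y ≡ 1#)

module Geometry {q : ℕ} (F : FiniteField q) where
  open FiniteField F

  Point : Set
  Point = Fin q × Fin q

  _−_ : Point → Point → Point
  (a , b) − (c , d) = (a + (- c)) , (b + (- d))

  _·_ : Point → Point → Fin q
  (a , b) · (c , d) = (a * c) + (b * d)

  sideLength : Point → Point → Fin q
  sideLength u v = (u − v) · (u − v)

  RightAt : Point → Point → Point → Set
  RightAt w u v = ((w − u) · (v − u)) ≡ 0#

  Quad : Set
  Quad = Point × Point × Point × Point

  GoodRectangle : Quad → Set
  GoodRectangle (u1 , u2 , u3 , u4) =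
    (RightAt u4 u1 u2 × RightAt u1 u2 u3 × RightAt u2 u3 u4 × RightAt u3 u4 u1)
    × (sideLength u1 u2 ≢ 0# × sideLength u2 u3 ≢ 0#
       × sideLength u3 u4 ≢ 0# × sideLength u4 u1 ≢ 0#)

  private
    nz? : ∀ x → Dec (x ≢ 0#)
    nz? x = ¬? (x ≟ᶠ 0#)
    ra? : ∀ w u v → Dec (RightAt w u v)
    ra? w u v = ((w − u) · (v − u)) ≟ᶠ 0#

  goodRectangle? : ∀ Q → Dec (GoodRectangle Q)
  goodRectangle? (u1 , u2 , u3 , u4) =
    (ra? u4 u1 u2 ×-dec ra? u1 u2 u3 ×-dec ra? u2 u3 u4 ×-dec ra? u3 u4 u1)
    ×-dec (nz? (sideLength u1 u2) ×-dec nz? (sideLength u2 u3)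
           ×-dec nz? (sideLength u3 u4) ×-dec nz? (sideLength u4 u1))

  allPoints : List Point
  allPoints = cartesianProduct (allFin q) (allFin q)

  Subset² : Set
  Subset² = Point → Bool

  elems : Subset² → List Point
  elems S = filter (λ u → Data.Bool._≟_ (S u) true) allPoints

  card : Subset² → ℕ
  card S = length (elems S)

  quads : Subset² → List Quad
  quads S = cartesianProduct (elems S)
              (cartesianProduct (elems S) (cartesianProduct (elems S) (elems S)))

  -- number of rectangles (ordered quadruples) with vertices in S and
  -- non-zero side-lengths
  rectangleCount : Subset² → ℕ
  rectangleCount S = length (filter goodRectangle? (quads S))

module Submission where

-- For a slope t with 1 + t² ≠ 0 the directions (1 , t) and (- t , 1) are orthogonal and not
-- isotropic, so in the coordinates (s , r) ↦ (s - t r , r + t s) every axis-parallel rectangle of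
-- the q × q grid with distinct rows and distinct columns is a rectangle with non-zero sides, and its
-- first side recovers t. For a grid set of size N, Cauchy–Schwarz over the columns and then over
-- pairs of rows gives N⁴ ≤ q⁴ (R + 2qN) with R its number of such rectangles; when N³ ≥ 4q⁵ this
-- means N⁴ ≤ 2q⁴ R. At most two slopes satisfy 1 + t² = 0, and summing over the remaining
-- q - 2 ≥ q/3 slopes gives N⁴ ≤ 6q³ · #rectangles.

open import Defs
open import Data.Nat.Base using (ℕ)
open import Algebra.Bundles using (CommutativeRing)

module IntegersAsDifferences where

  open import Data.Nat.Base as ℕ using (ℕ; suc)
  open import Data.Integer.Base as ℤ using (ℤ; +_; -[1+_])
  import Data.Integer.Properties as ℤ
  open import Data.Integer.Tactic.RingSolver as ℤ-Solver using ()
  open import Relation.Binary.PropositionalEquality.Core as ≡ using (_≡_)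
  import Relation.Binary.PropositionalEquality.Properties as ≡

  pos neg : ℤ → ℕ
  pos (+ n)    = n
  pos -[1+ n ] = 0
  neg (+ n)    = 0
  neg -[1+ n ] = suc n

  pos-neg : ∀ i → i ≡ + pos i ℤ.- + neg i
  pos-neg (+ n)    = ≡.sym (ℤ.+-identityʳ (+ n))
  pos-neg -[1+ n ] = ≡.refl

  difference-cross : ∀ a b c d → + a ℤ.- + b ≡ + c ℤ.- + d → a ℕ.+ d ≡ c ℕ.+ b
  difference-cross a b c d eq = ℤ.+-injective (begin
    + (a ℕ.+ d)                  ≡⟨ ℤ.pos-+ a d ⟩
    + a ℤ.+ + d                  ≡⟨ shift (+ a) (+ b) (+ d) ⟩
    (+ a ℤ.- + b) ℤ.+ (+ b ℤ.+ + d) ≡⟨ ≡.cong (ℤ._+ (+ b ℤ.+ + d)) eq ⟩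
    (+ c ℤ.- + d) ℤ.+ (+ b ℤ.+ + d) ≡⟨ unshift (+ c) (+ d) (+ b) ⟩
    + c ℤ.+ + b                  ≡⟨ ℤ.pos-+ c b ⟨
    + (c ℕ.+ b)                  ∎)
    where
    open ≡.≡-Reasoning
    shift : ∀ x y z → x ℤ.+ z ≡ (x ℤ.- y) ℤ.+ (y ℤ.+ z)
    shift = ℤ-Solver.solve-∀
    unshift : ∀ x y z → (x ℤ.- y) ℤ.+ (z ℤ.+ y) ≡ x ℤ.+ z
    unshift = ℤ-Solver.solve-∀

  +-as-difference : ∀ i j → i ℤ.+ j ≡ + (pos i ℕ.+ pos j) ℤ.- + (neg i ℕ.+ neg j)
  +-as-difference i j = begin
    i ℤ.+ j                                          ≡⟨ ≡.cong₂ ℤ._+_ (pos-neg i) (pos-neg j) ⟩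
    (+ pos i ℤ.- + neg i) ℤ.+ (+ pos j ℤ.- + neg j)  ≡⟨ regroup (+ pos i) (+ neg i) (+ pos j) (+ neg j) ⟩
    (+ pos i ℤ.+ + pos j) ℤ.- (+ neg i ℤ.+ + neg j)
      ≡⟨ ≡.cong₂ ℤ._-_ (ℤ.pos-+ (pos i) (pos j)) (ℤ.pos-+ (neg i) (neg j)) ⟨
    + (pos i ℕ.+ pos j) ℤ.- + (neg i ℕ.+ neg j)      ∎
    where
    open ≡.≡-Reasoning
    regroup : ∀ a b c d → (a ℤ.- b) ℤ.+ (c ℤ.- d) ≡ (a ℤ.+ c) ℤ.- (b ℤ.+ d)
    regroup = ℤ-Solver.solve-∀

  *-as-difference : ∀ i j → i ℤ.* j ≡ + (pos i ℕ.* pos j ℕ.+ neg i ℕ.* neg j) ℤ.- + (pos i ℕ.* neg j ℕ.+ neg i ℕ.* pos j)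
  *-as-difference i j = begin
    i ℤ.* j                                          ≡⟨ ≡.cong₂ ℤ._*_ (pos-neg i) (pos-neg j) ⟩
    (+ a ℤ.- + b) ℤ.* (+ c ℤ.- + d)                  ≡⟨ expand (+ a) (+ b) (+ c) (+ d) ⟩
    (+ a ℤ.* + c ℤ.+ + b ℤ.* + d) ℤ.- (+ a ℤ.* + d ℤ.+ + b ℤ.* + c)
      ≡⟨ ≡.cong₂ ℤ._-_ (pos-*+* a c b d) (pos-*+* a d b c) ⟨
    + (a ℕ.* c ℕ.+ b ℕ.* d) ℤ.- + (a ℕ.* d ℕ.+ b ℕ.* c) ∎
    where
    open ≡.≡-Reasoning
    a = pos i; b = neg i; c = pos j; d = neg j
    expand : ∀ a b c d → (a ℤ.- b) ℤ.* (c ℤ.- d) ≡ (a ℤ.* c ℤ.+ b ℤ.* d) ℤ.- (a ℤ.* d ℤ.+ b ℤ.* c)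
    expand = ℤ-Solver.solve-∀
    pos-*+* : ∀ w x y z → + (w ℕ.* x ℕ.+ y ℕ.* z) ≡ + w ℤ.* + x ℤ.+ + y ℤ.* + z
    pos-*+* w x y z = ≡.trans (ℤ.pos-+ (w ℕ.* x) (y ℕ.* z)) (≡.cong₂ ℤ._+_ (ℤ.pos-* w x) (ℤ.pos-* y z))

  neg-as-difference : ∀ i → ℤ.- i ≡ + neg i ℤ.- + pos i
  neg-as-difference i = ≡.trans (≡.cong ℤ.-_ (pos-neg i)) (flip (+ pos i) (+ neg i))
    where
    flip : ∀ a b → ℤ.- (a ℤ.- b) ≡ b ℤ.- a
    flip = ℤ-Solver.solve-∀

-- Tactic.RingSolver normalises with coefficients in the ring itself, where zero tests such as
-- 1# + - 1# ≟ 0# do not compute for an abstract ring; integer coefficients make them compute.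
module IntegerCoefficientRingSolver {r ℓ} (R : CommutativeRing r ℓ) where

  open import Data.Bool.Base using (Bool; true; false; T)
  open import Data.Maybe.Base using (nothing)
  open import Data.Nat.Base as ℕ using (ℕ; zero; suc)
  open import Data.Integer.Base as ℤ using (ℤ; +_; -[1+_])
  open import Data.Vec.Base using (Vec)
  open import Relation.Binary.PropositionalEquality.Core as ≡ using (_≡_)
  open import Tactic.RingSolver.Core.AlmostCommutativeRing using (AlmostCommutativeRing; fromCommutativeRing)
  open import Tactic.RingSolver.Core.Polynomial.Parameters using (Homomorphism)
  open IntegersAsDifferences

  open CommutativeRing R
  open import Algebra.Properties.Ring ring
    using (-‿+-comm; -‿distribˡ-*; -‿distribʳ-*; -‿involutive; -0#≈0#; ⁻¹-anti-homo‿-)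
  open import Algebra.Properties.CommutativeSemigroup +-commutativeSemigroup
    using () renaming (interchange to +-interchange)
  open import Algebra.Properties.Semiring.Mult.TCOptimised semiring using (_×_; ×-homo-+; ×1-homo-*)
  open import Relation.Binary.Reasoning.Setoid setoid

  -- The optimised _×_ has 1 × x = x, so Κ (+ 0) and Κ (+ 1) denote 0# and 1# definitionally.
  ⌊_⌋ : ℕ → Carrier
  ⌊ n ⌋ = n × 1#

  ⟦_⟧ℤ : ℤ → Carrier
  ⟦ + n ⟧ℤ      = ⌊ n ⌋
  ⟦ -[1+ n ] ⟧ℤ = - ⌊ suc n ⌋

  private
    -‿distrib-+ : ∀ a b → - (a + b) ≈ - a + - b
    -‿distrib-+ a b = sym (-‿+-comm a b)

    sub-+ : ∀ a b c d → (a + c) - (b + d) ≈ (a - b) + (c - d)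
    sub-+ a b c d = trans (+-congˡ (-‿distrib-+ b d)) (+-interchange a c (- b) (- d))

    sub-cancel : ∀ a b c → (a + c) - (b + c) ≈ a - b
    sub-cancel a b c = begin
      (a + c) - (b + c)   ≈⟨ sub-+ a b c c ⟩
      (a - b) + (c - c)   ≈⟨ +-congˡ (-‿inverseʳ c) ⟩
      (a - b) + 0#        ≈⟨ +-identityʳ _ ⟩
      a - b               ∎

    sub-* : ∀ a b c d → (a - b) * (c - d) ≈ (a * c + b * d) - (a * d + b * c)
    sub-* a b c d = begin
      (a - b) * (c - d)                           ≈⟨ distribʳ (c - d) a (- b) ⟩
      a * (c - d) + - b * (c - d)                 ≈⟨ +-cong (distribˡ a c (- d)) (distribˡ (- b) c (- d)) ⟩
      (a * c + a * - d) + (- b * c + - b * - d)   ≈⟨ +-cong (+-congˡ (sym (-‿distribʳ-* a d)))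
                                                            (+-cong (sym (-‿distribˡ-* b c)) neg-neg) ⟩
      (a * c + - (a * d)) + (- (b * c) + b * d)   ≈⟨ +-congˡ (+-comm _ _) ⟩
      (a * c + - (a * d)) + (b * d + - (b * c))   ≈⟨ +-interchange _ _ _ _ ⟩
      (a * c + b * d) + (- (a * d) + - (b * c))   ≈⟨ +-congˡ (sym (-‿distrib-+ _ _)) ⟩
      (a * c + b * d) - (a * d + b * c)           ∎
      where
      neg-neg : - b * - d ≈ b * d
      neg-neg = trans (sym (-‿distribˡ-* b (- d))) (trans (-‿cong (sym (-‿distribʳ-* b d))) (-‿involutive _))

    ⌊⌋-+ : ∀ m n → ⌊ m ℕ.+ n ⌋ ≈ ⌊ m ⌋ + ⌊ n ⌋
    ⌊⌋-+ = ×-homo-+ 1#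

    ⌊⌋-difference : ∀ a b c d → a ℕ.+ d ≡ c ℕ.+ b → ⌊ a ⌋ - ⌊ b ⌋ ≈ ⌊ c ⌋ - ⌊ d ⌋
    ⌊⌋-difference a b c d eq = begin
      ⌊ a ⌋ - ⌊ b ⌋                   ≈⟨ sub-cancel _ _ ⌊ d ⌋ ⟨
      (⌊ a ⌋ + ⌊ d ⌋) - (⌊ b ⌋ + ⌊ d ⌋) ≈⟨ +-cong (sym (⌊⌋-+ a d)) (-‿cong (sym (⌊⌋-+ b d))) ⟩
      ⌊ a ℕ.+ d ⌋ - ⌊ b ℕ.+ d ⌋         ≡⟨ ≡.cong₂ (λ x y → ⌊ x ⌋ - ⌊ y ⌋) eq (ℕP.+-comm b d) ⟩
      ⌊ c ℕ.+ b ⌋ - ⌊ d ℕ.+ b ⌋         ≈⟨ +-cong (⌊⌋-+ c b) (-‿cong (⌊⌋-+ d b)) ⟩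
      (⌊ c ⌋ + ⌊ b ⌋) - (⌊ d ⌋ + ⌊ b ⌋) ≈⟨ sub-cancel _ _ ⌊ b ⌋ ⟩
      ⌊ c ⌋ - ⌊ d ⌋                   ∎
      where import Data.Nat.Properties as ℕP

    ⟦⟧-pos-neg : ∀ i → ⟦ i ⟧ℤ ≈ ⌊ pos i ⌋ - ⌊ neg i ⌋
    ⟦⟧-pos-neg (+ n)    = sym (trans (+-congˡ -0#≈0#) (+-identityʳ ⌊ n ⌋))
    ⟦⟧-pos-neg -[1+ n ] = sym (+-identityˡ _)

    ⟦⟧-difference : ∀ i a b → i ≡ + a ℤ.- + b → ⟦ i ⟧ℤ ≈ ⌊ a ⌋ - ⌊ b ⌋
    ⟦⟧-difference i a b eq = trans (⟦⟧-pos-neg i)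
      (⌊⌋-difference (pos i) (neg i) a b (difference-cross (pos i) (neg i) a b (≡.trans (≡.sym (pos-neg i)) eq)))

  ⟦⟧-+ : ∀ i j → ⟦ i ℤ.+ j ⟧ℤ ≈ ⟦ i ⟧ℤ + ⟦ j ⟧ℤ
  ⟦⟧-+ i j = begin
    ⟦ i ℤ.+ j ⟧ℤ
      ≈⟨ ⟦⟧-difference (i ℤ.+ j) (pos i ℕ.+ pos j) (neg i ℕ.+ neg j) (+-as-difference i j) ⟩
    ⌊ pos i ℕ.+ pos j ⌋ - ⌊ neg i ℕ.+ neg j ⌋       ≈⟨ +-cong (⌊⌋-+ (pos i) (pos j)) (-‿cong (⌊⌋-+ (neg i) (neg j))) ⟩
    (⌊ pos i ⌋ + ⌊ pos j ⌋) - (⌊ neg i ⌋ + ⌊ neg j ⌋) ≈⟨ sub-+ _ _ _ _ ⟩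
    (⌊ pos i ⌋ - ⌊ neg i ⌋) + (⌊ pos j ⌋ - ⌊ neg j ⌋) ≈⟨ +-cong (⟦⟧-pos-neg i) (⟦⟧-pos-neg j) ⟨
    ⟦ i ⟧ℤ + ⟦ j ⟧ℤ                                 ∎

  ⟦⟧-* : ∀ i j → ⟦ i ℤ.* j ⟧ℤ ≈ ⟦ i ⟧ℤ * ⟦ j ⟧ℤ
  ⟦⟧-* i j = begin
    ⟦ i ℤ.* j ⟧ℤ
      ≈⟨ ⟦⟧-difference (i ℤ.* j) (a ℕ.* c ℕ.+ b ℕ.* d) (a ℕ.* d ℕ.+ b ℕ.* c) (*-as-difference i j) ⟩
    ⌊ a ℕ.* c ℕ.+ b ℕ.* d ⌋ - ⌊ a ℕ.* d ℕ.+ b ℕ.* c ⌋ ≈⟨ +-cong (⌊⌋-*+* a c b d) (-‿cong (⌊⌋-*+* a d b c)) ⟩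
    (⌊ a ⌋ * ⌊ c ⌋ + ⌊ b ⌋ * ⌊ d ⌋) - (⌊ a ⌋ * ⌊ d ⌋ + ⌊ b ⌋ * ⌊ c ⌋) ≈⟨ sub-* _ _ _ _ ⟨
    (⌊ a ⌋ - ⌊ b ⌋) * (⌊ c ⌋ - ⌊ d ⌋)               ≈⟨ *-cong (⟦⟧-pos-neg i) (⟦⟧-pos-neg j) ⟨
    ⟦ i ⟧ℤ * ⟦ j ⟧ℤ                                 ∎
    where
    a = pos i; b = neg i; c = pos j; d = neg j
    ⌊⌋-*+* : ∀ w x y z → ⌊ w ℕ.* x ℕ.+ y ℕ.* z ⌋ ≈ ⌊ w ⌋ * ⌊ x ⌋ + ⌊ y ⌋ * ⌊ z ⌋
    ⌊⌋-*+* w x y z = trans (⌊⌋-+ (w ℕ.* x) (y ℕ.* z)) (+-cong (×1-homo-* w x) (×1-homo-* y z))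

  ⟦⟧-neg : ∀ i → ⟦ ℤ.- i ⟧ℤ ≈ - ⟦ i ⟧ℤ
  ⟦⟧-neg i = begin
    ⟦ ℤ.- i ⟧ℤ           ≈⟨ ⟦⟧-difference (ℤ.- i) (neg i) (pos i) (neg-as-difference i) ⟩
    ⌊ neg i ⌋ - ⌊ pos i ⌋ ≈⟨ ⁻¹-anti-homo‿- ⌊ pos i ⌋ ⌊ neg i ⌋ ⟨
    - (⌊ pos i ⌋ - ⌊ neg i ⌋) ≈⟨ -‿cong (⟦⟧-pos-neg i) ⟨
    - ⟦ i ⟧ℤ              ∎

  isZero : ℤ → Bool
  isZero (+ zero) = true
  isZero _        = false

  zero-isZero : ∀ i → T (isZero i) → 0# ≈ ⟦ i ⟧ℤ
  zero-isZero (+ zero) _ = refl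

  integerCoefficients : Homomorphism _ _ _ _
  integerCoefficients = record
    { from = record { rawRing = ℤ.+-*-rawRing ; isZero = isZero }
    ; to = fromCommutativeRing R (λ _ → nothing)
    ; morphism = record
      { ⟦_⟧ = ⟦_⟧ℤ ; +-homo = ⟦⟧-+ ; *-homo = ⟦⟧-* ; -‿homo = ⟦⟧-neg
      ; 0-homo = refl ; 1-homo = refl }
    ; Zero-C⟶Zero-R = zero-isZero
    }

  private
    open import Tactic.RingSolver.Core.Expression using (Expr; Κ; Ι; _⊕_; _⊗_; ⊝_; _⊛_; module Eval)
    module ACR = AlmostCommutativeRing (Homomorphism.to integerCoefficients)
    open import Tactic.RingSolver.Core.Polynomial.Base (Homomorphism.from integerCoefficients)
    open import Tactic.RingSolver.Core.Polynomial.Homomorphism integerCoefficients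
    open import Algebra.Properties.Semiring.Exp.TCOptimised ACR.semiring using (^-congˡ)
    open Eval ACR.rawRing ⟦_⟧ℤ

    normalise : ∀ {n} → Expr ℤ n → Poly n
    normalise (Κ x)   = κ x
    normalise (Ι x)   = ι x
    normalise (x ⊕ y) = normalise x ⊞ normalise y
    normalise (x ⊗ y) = normalise x ⊠ normalise y
    normalise (⊝ x)   = ⊟ normalise x
    normalise (x ⊛ i) = normalise x ⊡ i

    ⟦_⇓⟧ : ∀ {n} → Expr ℤ n → Vec Carrier n → Carrier
    ⟦ e ⇓⟧ = ⟦ normalise e ⟧ₚ
      where open import Tactic.RingSolver.Core.Polynomial.Semantics integerCoefficients renaming (⟦_⟧ to ⟦_⟧ₚ)

    normalise-correct : ∀ {n} (e : Expr ℤ n) ρ → ⟦ e ⇓⟧ ρ ≈ ⟦ e ⟧ ρ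
    normalise-correct (Κ x)   ρ = κ-hom x ρ
    normalise-correct (Ι x)   ρ = ι-hom x ρ
    normalise-correct (x ⊕ y) ρ =
      trans (⊞-hom (normalise x) (normalise y) ρ) (+-cong (normalise-correct x ρ) (normalise-correct y ρ))
    normalise-correct (x ⊗ y) ρ =
      trans (⊠-hom (normalise x) (normalise y) ρ) (*-cong (normalise-correct x ρ) (normalise-correct y ρ))
    normalise-correct (⊝ x)   ρ = trans (⊟-hom (normalise x) ρ) (-‿cong (normalise-correct x ρ))
    normalise-correct (x ⊛ i) ρ = trans (⊡-hom (normalise x) i ρ) (^-congˡ i (normalise-correct x ρ))

  open import Tactic.RingSolver.Core.Expression public using (Expr; Κ; Ι; _⊕_; _⊗_; ⊝_; _⊛_)
  open import Relation.Binary.Reflection setoid Ι ⟦_⟧ ⟦_⇓⟧ normalise-correct public using (solve; _⊜_)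

module FiniteSums where

  open import Data.Nat.Base using (ℕ; zero; suc; _+_; _*_; _≤_; _<_; z≤n; s≤s)
  import Data.Nat.Properties as ℕ
  open import Data.Nat.Tactic.RingSolver using (solve-∀)
  open import Data.Fin.Base using (Fin; zero; suc)
  import Data.Fin.Properties as Fin
  open import Data.Product.Base using (_×_; _,_; proj₁; proj₂; ∃)
  open import Data.Product.Properties using (≡-dec)
  open import Data.Sum.Base using (inj₁; inj₂)
  open import Data.Empty using (⊥-elim)
  open import Function.Base using (_∘_)
  open import Relation.Binary.Definitions using (DecidableEquality)
  open import Relation.Binary.PropositionalEquality
  open import Relation.Nullary using (Dec; yes; no; ¬_)
  open import Relation.Nullary.Decidable using (_×-dec_; ¬?)
  open import Relation.Unary using (Pred; Decidable)
  import Algebra.Properties.Semiring.Sum ℕ.+-*-semiring as ℕΣ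

  𝟙 : ∀ {p} {P : Set p} → Dec P → ℕ
  𝟙 (yes _) = 1
  𝟙 (no _)  = 0

  𝟙-yes : ∀ {p} {P : Set p} (d : Dec P) → P → 𝟙 d ≡ 1
  𝟙-yes (yes _) _  = refl
  𝟙-yes (no ¬p) p  = ⊥-elim (¬p p)

  𝟙-no : ∀ {p} {P : Set p} (d : Dec P) → ¬ P → 𝟙 d ≡ 0
  𝟙-no (yes p) ¬p = ⊥-elim (¬p p)
  𝟙-no (no _)  _  = refl

  𝟙≤1 : ∀ {p} {P : Set p} (d : Dec P) → 𝟙 d ≤ 1
  𝟙≤1 (yes _) = ℕ.≤-refl
  𝟙≤1 (no _)  = z≤n

  𝟙-positive : ∀ {p} {P : Set p} (d : Dec P) → 0 < 𝟙 d → P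
  𝟙-positive (yes p) _ = p

  𝟙-× : ∀ {p q} {P : Set p} {Q : Set q} (d : Dec P) (e : Dec Q) → 𝟙 (d ×-dec e) ≡ 𝟙 d * 𝟙 e
  𝟙-× (yes _) (yes _) = refl
  𝟙-× (yes _) (no _)  = refl
  𝟙-× (no _)  _       = refl

  𝟙-¬?-+ : ∀ {p} {P : Set p} (d : Dec P) → 𝟙 (¬? d) + 𝟙 d ≡ 1
  𝟙-¬?-+ (yes _) = refl
  𝟙-¬?-+ (no _)  = refl

  data Shape : Set where
    fin : ℕ → Shape
    _⊗_ : Shape → Shape → Shape

  El : Shape → Set
  El (fin n) = Fin n
  El (σ ⊗ τ) = El σ × El τ

  ∣_∣ : Shape → ℕ
  ∣ fin n ∣ = n
  ∣ σ ⊗ τ ∣ = ∣ σ ∣ * ∣ τ ∣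

  decEq : ∀ σ → DecidableEquality (El σ)
  decEq (fin n) = Fin._≟_
  decEq (σ ⊗ τ) = ≡-dec (decEq σ) (decEq τ)

  δ : ∀ σ → El σ → El σ → ℕ
  δ σ x y = 𝟙 (decEq σ x y)

  ∑ : ∀ σ → (El σ → ℕ) → ℕ
  ∑ (fin n) f = ℕΣ.sum f
  ∑ (σ ⊗ τ) f = ∑ σ λ x → ∑ τ λ y → f (x , y)

  syntax ∑ σ (λ x → e) = ∑[ x ∈ σ ] e

  ∑-cong : ∀ σ {f g : El σ → ℕ} → (∀ x → f x ≡ g x) → ∑ σ f ≡ ∑ σ g
  ∑-cong (fin n) eq = ℕΣ.sum-cong-≗ eq
  ∑-cong (σ ⊗ τ) eq = ∑-cong σ λ x → ∑-cong τ λ y → eq (x , y)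

  ∑-mono-≤ : ∀ σ {f g : El σ → ℕ} → (∀ x → f x ≤ g x) → ∑ σ f ≤ ∑ σ g
  ∑-mono-≤ (fin zero)    le = z≤n
  ∑-mono-≤ (fin (suc n)) le = ℕ.+-mono-≤ (le zero) (∑-mono-≤ (fin n) (le ∘ suc))
  ∑-mono-≤ (σ ⊗ τ)       le = ∑-mono-≤ σ λ x → ∑-mono-≤ τ λ y → le (x , y)

  *-distribˡ-∑ : ∀ σ c (f : El σ → ℕ) → c * ∑ σ f ≡ ∑[ x ∈ σ ] (c * f x)
  *-distribˡ-∑ (fin n) c f = ℕΣ.*-distribˡ-sum c f
  *-distribˡ-∑ (σ ⊗ τ) c f = trans (*-distribˡ-∑ σ c _) (∑-cong σ λ x → *-distribˡ-∑ τ c λ y → f (x , y))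

  *-distribʳ-∑ : ∀ σ c (f : El σ → ℕ) → ∑ σ f * c ≡ ∑[ x ∈ σ ] (f x * c)
  *-distribʳ-∑ σ c f = trans (ℕ.*-comm (∑ σ f) c) (trans (*-distribˡ-∑ σ c f) (∑-cong σ λ x → ℕ.*-comm c (f x)))

  ∑-distrib-+ : ∀ σ (f g : El σ → ℕ) → ∑[ x ∈ σ ] (f x + g x) ≡ ∑ σ f + ∑ σ g
  ∑-distrib-+ (fin n) f g = ℕΣ.∑-distrib-+ f g
  ∑-distrib-+ (σ ⊗ τ) f g =
    trans (∑-cong σ λ x → ∑-distrib-+ τ (λ y → f (x , y)) (λ y → g (x , y))) (∑-distrib-+ σ _ _)

  ∑-comm : ∀ σ τ (f : El σ → El τ → ℕ) → ∑[ x ∈ σ ] ∑[ y ∈ τ ] f x y ≡ ∑[ y ∈ τ ] ∑[ x ∈ σ ] f x y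
  ∑-comm (fin m) (fin n) f = ℕΣ.∑-comm f
  ∑-comm (fin m) (τ ⊗ υ) f =
    trans (∑-comm (fin m) τ _) (∑-cong τ λ y → ∑-comm (fin m) υ λ x z → f x (y , z))
  ∑-comm (σ ⊗ υ) τ f =
    trans (∑-cong σ λ x → ∑-comm υ τ λ z y → f (x , z) y) (∑-comm σ τ λ x y → ∑[ z ∈ υ ] f (x , z) y)

  ∑-const : ∀ σ c → ∑[ _ ∈ σ ] c ≡ ∣ σ ∣ * c
  ∑-const (fin zero)    c = refl
  ∑-const (fin (suc n)) c = cong (c +_) (∑-const (fin n) c)
  ∑-const (σ ⊗ τ)       c = begin
    ∑[ _ ∈ σ ] ∑[ _ ∈ τ ] c ≡⟨ ∑-cong σ (λ _ → ∑-const τ c) ⟩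
    ∑[ _ ∈ σ ] (∣ τ ∣ * c)  ≡⟨ ∑-const σ (∣ τ ∣ * c) ⟩
    ∣ σ ∣ * (∣ τ ∣ * c)     ≡⟨ ℕ.*-assoc ∣ σ ∣ ∣ τ ∣ c ⟨
    ∣ σ ∣ * ∣ τ ∣ * c       ∎
    where open ≡-Reasoning

  ∑-zero : ∀ σ {f : El σ → ℕ} → (∀ x → f x ≡ 0) → ∑ σ f ≡ 0
  ∑-zero σ eq = trans (∑-cong σ eq) (trans (∑-const σ 0) (ℕ.*-zeroʳ ∣ σ ∣))

  ∑-single : ∀ σ {f : El σ → ℕ} a → (∀ x → x ≢ a → f x ≡ 0) → ∑ σ f ≡ f a
  ∑-single (fin (suc n)) {f} zero    off =
    trans (cong (f zero +_) (∑-zero (fin n) λ x → off (suc x) λ ())) (ℕ.+-identityʳ (f zero))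
  ∑-single (fin (suc n)) {f} (suc a) off =
    trans (cong (_+ ∑ (fin n) (f ∘ suc)) (off zero λ ()))
          (∑-single (fin n) a λ x x≢a → off (suc x) (x≢a ∘ Fin.suc-injective))
  ∑-single (σ ⊗ τ) {f} (a , b) off = trans (∑-single σ a off-row) (∑-single τ b λ y y≢b → off (a , y) (y≢b ∘ cong proj₂))
    where
    off-row : ∀ x → x ≢ a → ∑[ y ∈ τ ] f (x , y) ≡ 0
    off-row x x≢a = ∑-zero τ λ y → off (x , y) (x≢a ∘ cong proj₁)

  private
    sum-positive : ∀ {n} {f : Fin n → ℕ} → 0 < ℕΣ.sum f → ∃ λ x → 0 < f x
    sum-positive {suc n} {f} pos with f zero in eq
    ... | suc _ = zero , subst (0 <_) (sym eq) (s≤s z≤n)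
    ... | zero with sum-positive {n} pos
    ...   | x , fx>0 = suc x , fx>0

  ∑-positive : ∀ σ {f : El σ → ℕ} → 0 < ∑ σ f → ∃ λ x → 0 < f x
  ∑-positive (fin n) pos = sum-positive pos
  ∑-positive (σ ⊗ τ) pos with ∑-positive σ pos
  ... | x , row>0 with ∑-positive τ row>0
  ...   | y , fxy>0 = (x , y) , fxy>0

  ∑-δ : ∀ σ a (f : El σ → ℕ) → ∑[ x ∈ σ ] (δ σ x a * f x) ≡ f a
  ∑-δ σ a f = trans (∑-single σ a λ x x≢a → cong (_* f x) (𝟙-no (decEq σ x a) x≢a))
                    (trans (cong (_* f a) (𝟙-yes (decEq σ a a) refl)) (ℕ.+-identityʳ (f a)))

  ∑-δ≡1 : ∀ σ a → ∑[ x ∈ σ ] δ σ x a ≡ 1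
  ∑-δ≡1 σ a = trans (∑-cong σ λ x → sym (ℕ.*-identityʳ (δ σ x a))) (∑-δ σ a λ _ → 1)

  ∑-𝟙-unique : ∀ σ {p} {P : Pred (El σ) p} (P? : Decidable P) → (∀ {x y} → P x → P y → x ≡ y) →
               ∑[ x ∈ σ ] 𝟙 (P? x) ≤ 1
  ∑-𝟙-unique σ P? unique with ∑[ x ∈ σ ] 𝟙 (P? x) in eq
  ... | zero  = z≤n
  ... | suc k with ∑-positive σ {𝟙 ∘ P?} (subst (0 <_) (sym eq) (s≤s z≤n))
  ... | a , pa = begin
    suc k            ≡⟨ eq ⟨
    ∑[ x ∈ σ ] 𝟙 (P? x) ≡⟨ ∑-single σ a (λ x x≢a → 𝟙-no (P? x) (x≢a ∘ λ px → unique px (𝟙-positive (P? a) pa))) ⟩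
    𝟙 (P? a)         ≤⟨ 𝟙≤1 (P? a) ⟩
    1                ∎
    where open ℕ.≤-Reasoning

  𝟙-cong : ∀ {p q} {P : Set p} {Q : Set q} (d : Dec P) (e : Dec Q) → (P → Q) → (Q → P) → 𝟙 d ≡ 𝟙 e
  𝟙-cong (yes _) (yes _) _   _   = refl
  𝟙-cong (no _)  (no _)  _   _   = refl
  𝟙-cong (yes p) (no ¬q) p→q _   = ⊥-elim (¬q (p→q p))
  𝟙-cong (no ¬p) (yes q) _   q→p = ⊥-elim (¬p (q→p q))

  ∑-bijection : ∀ σ τ (g : El τ → El σ) (h : El σ → El τ) → (∀ x → g (h x) ≡ x) → (∀ y → h (g y) ≡ y) →
                (f : El σ → ℕ) → ∑ σ f ≡ ∑[ y ∈ τ ] f (g y)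
  ∑-bijection σ τ g h gh hg f = begin
    ∑ σ f                                         ≡⟨ ∑-cong σ (λ x → trans (∑-δ τ (h x) (f ∘ g)) (cong f (gh x))) ⟨
    ∑[ x ∈ σ ] ∑[ y ∈ τ ] (δ τ y (h x) * f (g y)) ≡⟨ ∑-comm σ τ _ ⟩
    ∑[ y ∈ τ ] ∑[ x ∈ σ ] (δ τ y (h x) * f (g y)) ≡⟨ ∑-cong τ (λ y → ∑-cong σ λ x → cong (_* f (g y)) (δ-swap x y)) ⟩
    ∑[ y ∈ τ ] ∑[ x ∈ σ ] (δ σ x (g y) * f (g y)) ≡⟨ ∑-cong τ (λ y → ∑-δ σ (g y) (λ _ → f (g y))) ⟩
    ∑[ y ∈ τ ] f (g y)                            ∎
    where
    open ≡-Reasoning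
    δ-swap : ∀ x y → δ τ y (h x) ≡ δ σ x (g y)
    δ-swap x y = 𝟙-cong (decEq τ y (h x)) (decEq σ x (g y))
      (λ y≡hx → trans (sym (gh x)) (cong g (sym y≡hx))) (λ x≡gy → trans (sym (hg y)) (cong h (sym x≡gy)))

  ∑-injection : ∀ σ τ {p} {W : Pred (El σ) p} (W? : Decidable W) (ι : El σ → El τ) →
                (∀ {x x′} → W x → W x′ → ι x ≡ ι x′ → x ≡ x′) →
                (g : El τ → ℕ) → ∑[ x ∈ σ ] (𝟙 (W? x) * g (ι x)) ≤ ∑ τ g
  ∑-injection σ τ {W = W} W? ι injective g = begin
    ∑[ x ∈ σ ] (𝟙 (W? x) * g (ι x))                          ≡⟨ ∑-cong σ (λ x → ∑-δ τ (ι x) λ y → 𝟙 (W? x) * g y) ⟨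
    ∑[ x ∈ σ ] ∑[ y ∈ τ ] (δ τ y (ι x) * (𝟙 (W? x) * g y)) ≡⟨ ∑-comm σ τ _ ⟩
    ∑[ y ∈ τ ] ∑[ x ∈ σ ] (δ τ y (ι x) * (𝟙 (W? x) * g y)) ≡⟨ ∑-cong τ (λ y → ∑-cong σ λ x → regroup x y) ⟩
    ∑[ y ∈ τ ] ∑[ x ∈ σ ] (𝟙 (fibre? y x) * g y)           ≡⟨ ∑-cong τ (λ y → *-distribʳ-∑ σ (g y) (𝟙 ∘ fibre? y)) ⟨
    ∑[ y ∈ τ ] (∑[ x ∈ σ ] 𝟙 (fibre? y x) * g y)
      ≤⟨ ∑-mono-≤ τ (λ y → ℕ.*-monoˡ-≤ (g y) (∑-𝟙-unique σ (fibre? y) unique)) ⟩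
    ∑[ y ∈ τ ] (1 * g y)                                    ≡⟨ ∑-cong τ (λ y → ℕ.*-identityˡ (g y)) ⟩
    ∑ τ g                                                   ∎
    where
    open ℕ.≤-Reasoning
    fibre? : ∀ y x → Dec (W x × y ≡ ι x)
    fibre? y x = W? x ×-dec decEq τ y (ι x)
    unique : ∀ {y x x′} → W x × y ≡ ι x → W x′ × y ≡ ι x′ → x ≡ x′
    unique (wx , y≡ιx) (wx′ , y≡ιx′) = injective wx wx′ (trans (sym y≡ιx) y≡ιx′)
    regroup : ∀ x y → δ τ y (ι x) * (𝟙 (W? x) * g y) ≡ 𝟙 (fibre? y x) * g y
    regroup x y = trans (rearrange (δ τ y (ι x)) (𝟙 (W? x)) (g y)) (cong (_* g y) (sym (𝟙-× (W? x) (decEq τ y (ι x)))))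
      where
      rearrange : ∀ a b c → a * (b * c) ≡ b * a * c
      rearrange = solve-∀

  ∑-*-∑ : ∀ σ τ (f : El σ → ℕ) (g : El τ → ℕ) → ∑ σ f * ∑ τ g ≡ ∑[ x ∈ σ ] ∑[ y ∈ τ ] (f x * g y)
  ∑-*-∑ σ τ f g = trans (*-distribʳ-∑ σ (∑ τ g) f) (∑-cong σ λ x → *-distribˡ-∑ τ (f x) g)

  private
    2mn≤m²+n²-ordered : ∀ {m n} → m ≤ n → 2 * (m * n) ≤ m * m + n * n
    2mn≤m²+n²-ordered {m} m≤n with ℕ.m≤n⇒∃[o]m+o≡n m≤n
    ... | k , refl = subst (2 * (m * (m + k)) ≤_) (square-gap m k) (ℕ.m≤m+n _ (k * k))
      where
      square-gap : ∀ m k → 2 * (m * (m + k)) + k * k ≡ m * m + (m + k) * (m + k)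
      square-gap = solve-∀

  2mn≤m²+n² : ∀ m n → 2 * (m * n) ≤ m * m + n * n
  2mn≤m²+n² m n with ℕ.≤-total m n
  ... | inj₁ m≤n = 2mn≤m²+n²-ordered m≤n
  ... | inj₂ n≤m = subst₂ _≤_ (cong (2 *_) (ℕ.*-comm n m)) (ℕ.+-comm (n * n) (m * m)) (2mn≤m²+n²-ordered n≤m)

  cauchy-schwarz : ∀ σ (f : El σ → ℕ) → ∑ σ f * ∑ σ f ≤ ∣ σ ∣ * ∑[ x ∈ σ ] (f x * f x)
  cauchy-schwarz σ f = ℕ.*-cancelˡ-≤ 2 (begin
    2 * (∑ σ f * ∑ σ f)                                       ≡⟨ cong (2 *_) (∑-*-∑ σ σ f f) ⟩
    2 * ∑[ x ∈ σ ] ∑[ y ∈ σ ] (f x * f y)                    ≡⟨ *-distribˡ-∑ (σ ⊗ σ) 2 _ ⟩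
    ∑[ x ∈ σ ] ∑[ y ∈ σ ] (2 * (f x * f y))                  ≤⟨ ∑-mono-≤ (σ ⊗ σ) (λ (x , y) → 2mn≤m²+n² (f x) (f y)) ⟩
    ∑[ x ∈ σ ] ∑[ y ∈ σ ] (f x * f x + f y * f y)            ≡⟨ ∑-distrib-+ (σ ⊗ σ) _ _ ⟩
    ∑[ x ∈ σ ] ∑[ _ ∈ σ ] (f x * f x) + ∑[ _ ∈ σ ] ∑[ y ∈ σ ] (f y * f y)
      ≡⟨ cong₂ _+_ (trans (∑-cong σ λ x → ∑-const σ (f x * f x)) (sym (*-distribˡ-∑ σ ∣ σ ∣ _))) (∑-const σ _) ⟩
    Q + Q                                                     ≡⟨ cong (Q +_) (ℕ.+-identityʳ Q) ⟨
    2 * Q                                                     ∎)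
    where
    open ℕ.≤-Reasoning
    Q = ∣ σ ∣ * ∑[ x ∈ σ ] (f x * f x)

open FiniteSums

module Grid (σ τ : Shape) where

  open import Data.Nat.Base using (ℕ; _+_; _*_; _≤_; z≤n; s≤s)
  import Data.Nat.Properties as ℕ
  open import Data.Nat.Tactic.RingSolver using (solve-∀)
  open import Data.Product.Base using (_×_; _,_)
  open import Relation.Binary.PropositionalEquality
  open import Relation.Nullary using (Dec; yes; no)
  open import Relation.Nullary.Decidable using (_×-dec_; ¬?)

  □ : Shape
  □ = σ ⊗ (τ ⊗ (σ ⊗ τ))

  apart? : ∀ s r s′ r′ → Dec (s′ ≢ s × r′ ≢ r)
  apart? s r s′ r′ = ¬? (decEq σ s′ s) ×-dec ¬? (decEq τ r′ r)

  module PointSet {p} {A : El σ → El τ → Set p} (A? : ∀ s r → Dec (A s r)) where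

    χ : El σ → El τ → ℕ
    χ s r = 𝟙 (A? s r)

    corners : El σ → El τ → El σ → El τ → ℕ
    corners s r s′ r′ = χ s r * (χ s′ r * (χ s′ r′ * χ s r′))

    size rectangles : ℕ
    size = ∑[ s ∈ σ ] ∑[ r ∈ τ ] χ s r
    rectangles = ∑ □ λ (s , r , s′ , r′) → 𝟙 (apart? s r s′ r′) * corners s r s′ r′

    private
      m = ∣ σ ∣
      n = ∣ τ ∣

      corners≤χ : ∀ s r s′ r′ → corners s r s′ r′ ≤ χ s r
      corners≤χ s r s′ r′ = ℕ.≤-trans
        (ℕ.*-monoʳ-≤ (χ s r) (ℕ.*-mono-≤ (𝟙≤1 (A? s′ r)) (ℕ.*-mono-≤ (𝟙≤1 (A? s′ r′)) (𝟙≤1 (A? s r′)))))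
        (ℕ.≤-reflexive (ℕ.*-identityʳ (χ s r)))

      cover : ∀ s r s′ r′ → 1 ≤ 𝟙 (¬? (decEq σ s′ s) ×-dec ¬? (decEq τ r′ r)) + δ σ s′ s + δ τ r′ r
      cover s r s′ r′ with decEq σ s′ s | decEq τ r′ r
      ... | yes _ | _     = s≤s z≤n
      ... | no _  | yes _ = s≤s z≤n
      ... | no _  | no _  = s≤s z≤n

      sum-bounded-by-χ : ∀ c (f : El σ → El τ → ℕ) → (∀ s r → f s r ≤ c * χ s r) →
                         ∑[ s ∈ σ ] ∑[ r ∈ τ ] f s r ≤ c * size
      sum-bounded-by-χ c f le =
        ℕ.≤-trans (∑-mono-≤ (σ ⊗ τ) λ (s , r) → le s r) (ℕ.≤-reflexive (sym (*-distribˡ-∑ (σ ⊗ τ) c _)))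

      equal-rows : ∑ □ (λ (s , r , s′ , r′) → δ σ s′ s * corners s r s′ r′) ≤ n * size
      equal-rows = sum-bounded-by-χ n _ λ s r → begin
        ∑[ s′ ∈ σ ] ∑[ r′ ∈ τ ] (δ σ s′ s * corners s r s′ r′) ≡⟨ ∑-cong σ (λ s′ → *-distribˡ-∑ τ (δ σ s′ s) _) ⟨
        ∑[ s′ ∈ σ ] (δ σ s′ s * ∑[ r′ ∈ τ ] corners s r s′ r′) ≡⟨ ∑-δ σ s _ ⟩
        ∑[ r′ ∈ τ ] corners s r s r′                          ≤⟨ ∑-mono-≤ τ (corners≤χ s r s) ⟩
        ∑[ r′ ∈ τ ] χ s r                                     ≡⟨ ∑-const τ (χ s r) ⟩
        n * χ s r                                             ∎
        where open ℕ.≤-Reasoning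

      equal-columns : ∑ □ (λ (s , r , s′ , r′) → δ τ r′ r * corners s r s′ r′) ≤ m * size
      equal-columns = sum-bounded-by-χ m _ λ s r → begin
        ∑[ s′ ∈ σ ] ∑[ r′ ∈ τ ] (δ τ r′ r * corners s r s′ r′) ≡⟨ ∑-cong σ (λ s′ → ∑-δ τ r _) ⟩
        ∑[ s′ ∈ σ ] corners s r s′ r                          ≤⟨ ∑-mono-≤ σ (λ s′ → corners≤χ s r s′ r) ⟩
        ∑[ s′ ∈ σ ] χ s r                                     ≡⟨ ∑-const σ (χ s r) ⟩
        m * χ s r                                             ∎
        where open ℕ.≤-Reasoning

      all-corners≤ : ∑ □ (λ (s , r , s′ , r′) → corners s r s′ r′) ≤ rectangles + (m + n) * size
      all-corners≤ = begin
        ∑ □ (λ (s , r , s′ , r′) → corners s r s′ r′)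
          ≤⟨ ∑-mono-≤ □ split ⟩
        ∑ □ (λ x → (rect x + row x + col x))
          ≡⟨ trans (∑-distrib-+ □ (λ x → rect x + row x) col) (cong (_+ ∑ □ col) (∑-distrib-+ □ rect row)) ⟩
        rectangles + ∑ □ row + ∑ □ col
          ≤⟨ ℕ.+-mono-≤ (ℕ.+-monoʳ-≤ rectangles equal-rows) equal-columns ⟩
        rectangles + n * size + m * size
          ≡⟨ regroup rectangles n m size ⟩
        rectangles + (m + n) * size ∎
        where
        open ℕ.≤-Reasoning
        expand : ∀ a b c x → (a + b + c) * x ≡ a * x + b * x + c * x
        expand = solve-∀
        regroup : ∀ R n m N → R + n * N + m * N ≡ R + (m + n) * N
        regroup = solve-∀
        all rect row col : El □ → ℕ
        all  (s , r , s′ , r′) = corners s r s′ r′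
        rect (s , r , s′ , r′) = 𝟙 (apart? s r s′ r′) * corners s r s′ r′
        row  (s , r , s′ , r′) = δ σ s′ s * corners s r s′ r′
        col  (s , r , s′ , r′) = δ τ r′ r * corners s r s′ r′
        split : ∀ x → all x ≤ rect x + row x + col x
        split (s , r , s′ , r′) = begin
          corners s r s′ r′                                          ≡⟨ ℕ.*-identityˡ _ ⟨
          1 * corners s r s′ r′                                      ≤⟨ ℕ.*-monoˡ-≤ _ (cover s r s′ r′) ⟩
          (𝟙 (apart? s r s′ r′) + δ σ s′ s + δ τ r′ r) * corners s r s′ r′
            ≡⟨ expand (𝟙 (apart? s r s′ r′)) (δ σ s′ s) (δ τ r′ r) (corners s r s′ r′) ⟩
          rect (s , r , s′ , r′) + row (s , r , s′ , r′) + col (s , r , s′ , r′) ∎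

      shared : El σ → El σ → ℕ
      shared s s′ = ∑[ r ∈ τ ] (χ s r * χ s′ r)

      size²≤ : size * size ≤ n * ∑[ s ∈ σ ] ∑[ s′ ∈ σ ] shared s s′
      size²≤ = begin
        size * size                                        ≡⟨ cong₂ _*_ columns columns ⟩
        ∑ τ column * ∑ τ column                            ≤⟨ cauchy-schwarz τ column ⟩
        n * ∑[ r ∈ τ ] (column r * column r)
          ≡⟨ cong (n *_) (∑-cong τ λ r → ∑-*-∑ σ σ (λ s → χ s r) (λ s → χ s r)) ⟩
        n * ∑[ r ∈ τ ] ∑[ s ∈ σ ] ∑[ s′ ∈ σ ] (χ s r * χ s′ r) ≡⟨ cong (n *_) (∑-comm τ (σ ⊗ σ) _) ⟩
        n * ∑[ s ∈ σ ] ∑[ s′ ∈ σ ] shared s s′             ∎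
        where
        open ℕ.≤-Reasoning
        column : El τ → ℕ
        column r = ∑[ s ∈ σ ] χ s r
        columns : size ≡ ∑ τ column
        columns = ∑-comm σ τ χ

      shared²≡corners : ∑[ s ∈ σ ] ∑[ s′ ∈ σ ] (shared s s′ * shared s s′) ≡ ∑ □ (λ (s , r , s′ , r′) → corners s r s′ r′)
      shared²≡corners = begin
        ∑[ s ∈ σ ] ∑[ s′ ∈ σ ] (shared s s′ * shared s s′)
          ≡⟨ ∑-cong (σ ⊗ σ) (λ (s , s′) → ∑-*-∑ τ τ (λ r → χ s r * χ s′ r) (λ r′ → χ s r′ * χ s′ r′)) ⟩
        ∑[ s ∈ σ ] ∑[ s′ ∈ σ ] ∑[ r ∈ τ ] ∑[ r′ ∈ τ ] ((χ s r * χ s′ r) * (χ s r′ * χ s′ r′))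
          ≡⟨ ∑-cong σ (λ s → ∑-comm σ τ λ s′ r → ∑[ r′ ∈ τ ] ((χ s r * χ s′ r) * (χ s r′ * χ s′ r′))) ⟩
        ∑[ s ∈ σ ] ∑[ r ∈ τ ] ∑[ s′ ∈ σ ] ∑[ r′ ∈ τ ] ((χ s r * χ s′ r) * (χ s r′ * χ s′ r′))
          ≡⟨ ∑-cong □ (λ (s , r , s′ , r′) → reorder (χ s r) (χ s′ r) (χ s r′) (χ s′ r′)) ⟩
        ∑ □ (λ (s , r , s′ , r′) → corners s r s′ r′) ∎
        where
        open ≡-Reasoning
        reorder : ∀ a b c d → (a * b) * (c * d) ≡ a * (b * (d * c))
        reorder = solve-∀

    size⁴≤ : size * size * (size * size) ≤ m * m * (n * n) * (rectangles + (m + n) * size)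
    size⁴≤ = begin
      size * size * (size * size)              ≤⟨ ℕ.*-mono-≤ size²≤ size²≤ ⟩
      n * M * (n * M)                          ≡⟨ square-product n M ⟩
      n * n * (M * M)
        ≤⟨ ℕ.*-monoʳ-≤ (n * n) (cauchy-schwarz (σ ⊗ σ) (λ (s , s′) → shared s s′)) ⟩
      n * n * (m * m * ∑[ s ∈ σ ] ∑[ s′ ∈ σ ] (shared s s′ * shared s s′))
        ≡⟨ cong (λ c → n * n * (m * m * c)) shared²≡corners ⟩
      n * n * (m * m * ∑ □ (λ (s , r , s′ , r′) → corners s r s′ r′))
        ≤⟨ ℕ.*-monoʳ-≤ (n * n) (ℕ.*-monoʳ-≤ (m * m) all-corners≤) ⟩
      n * n * (m * m * (rectangles + (m + n) * size)) ≡⟨ reassociate (n * n) (m * m) _ ⟩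
      m * m * (n * n) * (rectangles + (m + n) * size) ∎
      where
      open ℕ.≤-Reasoning
      M = ∑[ s ∈ σ ] ∑[ s′ ∈ σ ] shared s s′
      square-product : ∀ a b → a * b * (a * b) ≡ a * a * (b * b)
      square-product = solve-∀
      reassociate : ∀ a b c → a * (b * c) ≡ b * a * c
      reassociate = solve-∀

module ListSums where

  open import Level using (Level)
  open import Data.Nat.Base using (ℕ; zero; suc; _+_; _*_)
  import Data.Nat.Properties as ℕ
  open import Data.Fin.Base using (Fin; zero; suc)
  open import Data.List.Base using (List; []; _∷_; _++_; map; filter; length; cartesianProduct; tabulate; allFin)
  open import Data.Product.Base using (_×_; _,_)
  open import Function.Base using (_∘_; id)
  open import Relation.Binary.PropositionalEquality
  open import Relation.Nullary using (yes; no)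
  open import Relation.Unary using (Pred; Decidable)

  private
    variable
      a b p : Level
      A : Set a
      B : Set b

  ∑ˡ : (A → ℕ) → List A → ℕ
  ∑ˡ f []       = 0
  ∑ˡ f (x ∷ xs) = f x + ∑ˡ f xs

  ∑ˡ-++ : ∀ (f : A → ℕ) xs ys → ∑ˡ f (xs ++ ys) ≡ ∑ˡ f xs + ∑ˡ f ys
  ∑ˡ-++ f []       ys = refl
  ∑ˡ-++ f (x ∷ xs) ys = trans (cong (f x +_) (∑ˡ-++ f xs ys)) (sym (ℕ.+-assoc (f x) _ _))

  length≡∑ˡ-𝟙 : ∀ {P : Pred A p} (P? : Decidable P) xs → length (filter P? xs) ≡ ∑ˡ (𝟙 ∘ P?) xs
  length≡∑ˡ-𝟙 P? []       = refl
  length≡∑ˡ-𝟙 P? (x ∷ xs) with P? x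
  ... | yes _ = cong suc (length≡∑ˡ-𝟙 P? xs)
  ... | no _  = length≡∑ˡ-𝟙 P? xs

  ∑ˡ-filter : ∀ {P : Pred A p} (P? : Decidable P) (f : A → ℕ) xs →
              ∑ˡ f (filter P? xs) ≡ ∑ˡ (λ x → 𝟙 (P? x) * f x) xs
  ∑ˡ-filter P? f []       = refl
  ∑ˡ-filter P? f (x ∷ xs) with P? x
  ... | yes _ = cong₂ _+_ (sym (ℕ.+-identityʳ (f x))) (∑ˡ-filter P? f xs)
  ... | no _  = ∑ˡ-filter P? f xs

  ∑ˡ-map : ∀ (f : B → ℕ) (g : A → B) xs → ∑ˡ f (map g xs) ≡ ∑ˡ (f ∘ g) xs
  ∑ˡ-map f g []       = refl
  ∑ˡ-map f g (x ∷ xs) = cong (f (g x) +_) (∑ˡ-map f g xs)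

  ∑ˡ-cartesianProduct : ∀ (f : A × B → ℕ) xs ys →
                        ∑ˡ f (cartesianProduct xs ys) ≡ ∑ˡ (λ x → ∑ˡ (λ y → f (x , y)) ys) xs
  ∑ˡ-cartesianProduct f []       ys = refl
  ∑ˡ-cartesianProduct f (x ∷ xs) ys =
    trans (∑ˡ-++ f (map (x ,_) ys) _) (cong₂ _+_ (∑ˡ-map f (x ,_) ys) (∑ˡ-cartesianProduct f xs ys))

  enumerate : ∀ σ → List (El σ)
  enumerate (fin n) = allFin n
  enumerate (σ ⊗ τ) = cartesianProduct (enumerate σ) (enumerate τ)

  ∑ˡ-tabulate : ∀ {n} (f : A → ℕ) (g : Fin n → A) → ∑ˡ f (tabulate g) ≡ ∑ (fin n) (f ∘ g)
  ∑ˡ-tabulate {n = zero}  f g = refl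
  ∑ˡ-tabulate {n = suc n} f g = cong (f (g zero) +_) (∑ˡ-tabulate f (g ∘ suc))

  ∑ˡ-enumerate : ∀ σ (f : El σ → ℕ) → ∑ˡ f (enumerate σ) ≡ ∑ σ f
  ∑ˡ-enumerate (fin n) f = ∑ˡ-tabulate f id
  ∑ˡ-enumerate (σ ⊗ τ) f = begin
    ∑ˡ f (cartesianProduct (enumerate σ) (enumerate τ))       ≡⟨ ∑ˡ-cartesianProduct f (enumerate σ) (enumerate τ) ⟩
    ∑ˡ (λ x → ∑ˡ (λ y → f (x , y)) (enumerate τ)) (enumerate σ) ≡⟨ ∑ˡ-enumerate σ _ ⟩
    ∑[ x ∈ σ ] ∑ˡ (λ y → f (x , y)) (enumerate τ)             ≡⟨ ∑-cong σ (λ x → ∑ˡ-enumerate τ λ y → f (x , y)) ⟩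
    ∑ (σ ⊗ τ) f                                                ∎
    where open ≡-Reasoning

  -- xs lists each x : El σ with multiplicity w x, as far as sums can tell
  record Enumerates σ (w : El σ → ℕ) (xs : List (El σ)) : Set where
    constructor enumerates
    field ∑ˡ≡∑ : ∀ f → ∑ˡ f xs ≡ ∑[ x ∈ σ ] (w x * f x)
  open Enumerates public

  filter-enumerate : ∀ σ {P : Pred (El σ) p} (P? : Decidable P) → Enumerates σ (𝟙 ∘ P?) (filter P? (enumerate σ))
  filter-enumerate σ P? = enumerates λ f → trans (∑ˡ-filter P? f (enumerate σ)) (∑ˡ-enumerate σ _)

  cartesianProduct-enumerates : ∀ σ τ {v w xs ys} → Enumerates σ v xs → Enumerates τ w ys →
                                Enumerates (σ ⊗ τ) (λ (x , y) → v x * w y) (cartesianProduct xs ys)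
  cartesianProduct-enumerates σ τ {v} {w} {xs} {ys} enum-xs enum-ys = enumerates λ f → begin
    ∑ˡ f (cartesianProduct xs ys)                   ≡⟨ ∑ˡ-cartesianProduct f xs ys ⟩
    ∑ˡ (λ x → ∑ˡ (λ y → f (x , y)) ys) xs           ≡⟨ ∑ˡ≡∑ enum-xs _ ⟩
    ∑[ x ∈ σ ] (v x * ∑ˡ (λ y → f (x , y)) ys)      ≡⟨ ∑-cong σ (λ x → cong (v x *_) (∑ˡ≡∑ enum-ys λ y → f (x , y))) ⟩
    ∑[ x ∈ σ ] (v x * ∑[ y ∈ τ ] (w y * f (x , y))) ≡⟨ ∑-cong σ (λ x → *-distribˡ-∑ τ (v x) _) ⟩
    ∑[ x ∈ σ ] ∑[ y ∈ τ ] (v x * (w y * f (x , y)))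
      ≡⟨ ∑-cong (σ ⊗ τ) (λ (x , y) → ℕ.*-assoc (v x) (w y) (f (x , y))) ⟨
    ∑[ x ∈ σ ] ∑[ y ∈ τ ] (v x * w y * f (x , y))   ∎
    where open ≡-Reasoning

open ListSums

module Arithmetic where

  open import Data.Nat.Base
  open import Data.Nat.Properties
  open import Data.Nat.Tactic.RingSolver using (solve-∀)
  open import Relation.Binary.PropositionalEquality using (_≡_; cong; sym)

  m≤n+o∧2o≤m⇒m≤2n : ∀ {m} n o → m ≤ n + o → 2 * o ≤ m → m ≤ 2 * n
  m≤n+o∧2o≤m⇒m≤2n {m} n o m≤n+o 2o≤m = +-cancelʳ-≤ m m (2 * n) (begin
    m + m           ≡⟨ cong (m +_) (+-identityʳ m) ⟨
    2 * m           ≤⟨ *-monoʳ-≤ 2 m≤n+o ⟩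
    2 * (n + o)     ≡⟨ *-distribˡ-+ 2 n o ⟩
    2 * n + 2 * o   ≤⟨ +-monoʳ-≤ (2 * n) 2o≤m ⟩
    2 * n + m       ∎)
    where open ≤-Reasoning

  n≤m+2⇒n≤3m : ∀ {n m} → 3 ≤ n → n ≤ m + 2 → n ≤ 3 * m
  n≤m+2⇒n≤3m {m = zero}  3≤n n≤2 with ≤-trans 3≤n n≤2
  ... | s≤s (s≤s ())
  n≤m+2⇒n≤3m {m = suc m} _ n≤m+2 = ≤-trans n≤m+2 (≤-trans (+-monoʳ-≤ (suc m) (s≤s (s≤s z≤n))) (≤-reflexive (sym (tripled m))))
    where
    tripled : ∀ m → 3 * suc m ≡ suc m + suc (suc (m + m))
    tripled = solve-∀

module Rectangles {q : ℕ} (F : FiniteField q) where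

  open import Data.Nat.Base as ℕ using (ℕ; z≤n; s≤s)
  import Data.Nat.Properties as ℕ
  open import Data.Fin.Base using (Fin)
  open import Data.Fin.Properties using (_≟_)
  open import Data.Product.Base using (_×_; _,_; proj₁; proj₂)
  open import Data.Sum.Base using (_⊎_; inj₁; inj₂)
  open import Data.Empty using (⊥-elim)
  open import Function.Base using (_∘_)
  open import Relation.Binary.PropositionalEquality
  open import Relation.Nullary using (Dec; yes; no)
  open import Relation.Nullary.Decidable using (_×-dec_; ¬?)

  open import Data.Integer.Base using (+_)
  open FiniteField F renaming (_+_ to infixl 6 _+_; _*_ to infixl 7 _*_; -_ to infix 8 -_)
  open Geometry F

  commutativeRing : CommutativeRing _ _
  commutativeRing = record { isCommutativeRing = isCommutativeRing }

  open CommutativeRing commutativeRing using (+-identityˡ; *-comm; *-assoc; *-identityˡ; zeroʳ; -‿inverseʳ; _-_)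
  open import Algebra.Properties.Ring (CommutativeRing.ring commutativeRing) using (x∙y⁻¹≈ε⇒x≈y)
  open IntegerCoefficientRingSolver commutativeRing

  x-y≢0 : ∀ {x y} → x ≢ y → x - y ≢ 0#
  x-y≢0 x≢y = x≢y ∘ x∙y⁻¹≈ε⇒x≈y _ _

  *-cancelˡ : ∀ {a} x y → a ≢ 0# → a * x ≡ a * y → x ≡ y
  *-cancelˡ {a} x y a≢0 eq = begin
    x               ≡⟨ unit x ⟨
    (b * a) * x     ≡⟨ *-assoc b a x ⟩
    b * (a * x)     ≡⟨ cong (b *_) eq ⟩
    b * (a * y)     ≡⟨ *-assoc b a y ⟨
    (b * a) * y     ≡⟨ unit y ⟩
    y               ∎
    where
    open ≡-Reasoning
    b = proj₁ (inverse a a≢0)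
    unit : ∀ z → (b * a) * z ≡ z
    unit z = trans (cong (_* z) (trans (*-comm b a) (proj₂ (inverse a a≢0)))) (*-identityˡ z)

  *-nonzero : ∀ {x y} → x ≢ 0# → y ≢ 0# → x * y ≢ 0#
  *-nonzero {x} {y} x≢0 y≢0 xy≡0 = y≢0 (*-cancelˡ y 0# x≢0 (trans xy≡0 (sym (zeroʳ x))))

  x²≡y²⇒x≡±y : ∀ {t t₀} → t * t ≡ t₀ * t₀ → t ≡ t₀ ⊎ t ≡ - t₀
  x²≡y²⇒x≡±y {t} {t₀} eq with t - t₀ ≟ 0# | t + t₀ ≟ 0#
  ... | yes d≡0 | _       = inj₁ (x∙y⁻¹≈ε⇒x≈y t t₀ d≡0)
  ... | no _    | yes s≡0 = inj₂ (trans (sym (cancel t t₀)) (trans (cong (_- t₀) s≡0) (+-identityˡ (- t₀))))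
    where
    cancel : ∀ t t₀ → (t + t₀) - t₀ ≡ t
    cancel = solve 2 (λ t t₀ → (t ⊕ t₀) ⊕ ⊝ t₀ ⊜ t) refl
  ... | no d≢0  | no s≢0  =
    ⊥-elim (*-nonzero d≢0 s≢0 (trans (factor t t₀) (trans (cong (_- (t₀ * t₀)) eq) (-‿inverseʳ (t₀ * t₀)))))
    where
    factor : ∀ t t₀ → (t - t₀) * (t + t₀) ≡ t * t - t₀ * t₀
    factor = solve 2 (λ t t₀ → (t ⊕ ⊝ t₀) ⊗ (t ⊕ t₀) ⊜ t ⊗ t ⊕ ⊝ (t₀ ⊗ t₀)) refl

  at-most-two-square-roots : ∀ c → ∑[ t ∈ fin q ] 𝟙 (t * t ≟ c) ℕ.≤ 2
  at-most-two-square-roots c with ∑[ t ∈ fin q ] 𝟙 (t * t ≟ c) in eq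
  ... | ℕ.zero  = z≤n
  ... | ℕ.suc k with ∑-positive (fin q) {λ t → 𝟙 (t * t ≟ c)} (subst (0 ℕ.<_) (sym eq) (s≤s z≤n))
  ... | t₀ , root = begin
    ℕ.suc k                                                             ≡⟨ eq ⟨
    ∑[ t ∈ fin q ] 𝟙 (t * t ≟ c)                                        ≤⟨ ∑-mono-≤ (fin q) bound ⟩
    ∑[ t ∈ fin q ] (δ (fin q) t t₀ ℕ.+ δ (fin q) t (- t₀))              ≡⟨ ∑-distrib-+ (fin q) _ _ ⟩
    ∑[ t ∈ fin q ] δ (fin q) t t₀ ℕ.+ ∑[ t ∈ fin q ] δ (fin q) t (- t₀)
      ≡⟨ cong₂ ℕ._+_ (∑-δ≡1 (fin q) t₀) (∑-δ≡1 (fin q) (- t₀)) ⟩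
    2                                                                   ∎
    where
    open ℕ.≤-Reasoning
    t₀-root : t₀ * t₀ ≡ c
    t₀-root = 𝟙-positive (t₀ * t₀ ≟ c) root
    bound : ∀ t → 𝟙 (t * t ≟ c) ℕ.≤ δ (fin q) t t₀ ℕ.+ δ (fin q) t (- t₀)
    bound t with t * t ≟ c
    ... | no _ = z≤n
    ... | yes t-root with x²≡y²⇒x≡±y (trans t-root (sym t₀-root))
    ...   | inj₁ t≡t₀  = ℕ.≤-trans (ℕ.≤-reflexive (sym (𝟙-yes (t ≟ t₀) t≡t₀))) (ℕ.m≤m+n _ _)
    ...   | inj₂ t≡-t₀ = ℕ.≤-trans (ℕ.≤-reflexive (sym (𝟙-yes (t ≟ - t₀) t≡-t₀))) (ℕ.m≤n+m _ _)

  Plane : Shape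
  Plane = fin q ⊗ fin q

  κ : Fin q → Fin q
  κ t = 1# + t * t

  nonIsotropic? : ∀ t → Dec (κ t ≢ 0#)
  nonIsotropic? t = ¬? (κ t ≟ 0#)

  frame : Fin q → Point → Point
  frame t (s , r) = (s - t * r , r + t * s)

  frame-side-row : ∀ t a b r → frame t (a , r) − frame t (b , r) ≡ (a - b , t * (a - b))
  frame-side-row t a b r = cong₂ _,_
    (solve 4 (λ t a b r → (a ⊕ ⊝ (t ⊗ r)) ⊕ ⊝ (b ⊕ ⊝ (t ⊗ r)) ⊜ a ⊕ ⊝ b) refl t a b r)
    (solve 4 (λ t a b r → (r ⊕ t ⊗ a) ⊕ ⊝ (r ⊕ t ⊗ b) ⊜ t ⊗ (a ⊕ ⊝ b)) refl t a b r)

  frame-side-column : ∀ t s a b → frame t (s , a) − frame t (s , b) ≡ (- (t * (a - b)) , a - b)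
  frame-side-column t s a b = cong₂ _,_
    (solve 4 (λ t s a b → (s ⊕ ⊝ (t ⊗ a)) ⊕ ⊝ (s ⊕ ⊝ (t ⊗ b)) ⊜ ⊝ (t ⊗ (a ⊕ ⊝ b))) refl t s a b)
    (solve 4 (λ t s a b → (a ⊕ t ⊗ s) ⊕ ⊝ (b ⊕ t ⊗ s) ⊜ a ⊕ ⊝ b) refl t s a b)

  sideLength-row : ∀ t a b r → sideLength (frame t (a , r)) (frame t (b , r)) ≡ (a - b) * (a - b) * κ t
  sideLength-row t a b r = trans (cong (λ v → v · v) (frame-side-row t a b r)) (length² t (a - b))
    where
    length² : ∀ t d → d * d + t * d * (t * d) ≡ d * d * κ t
    length² = solve 2 (λ t d → d ⊗ d ⊕ t ⊗ d ⊗ (t ⊗ d) ⊜ d ⊗ d ⊗ (Κ (+ 1) ⊕ t ⊗ t)) refl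

  sideLength-column : ∀ t s a b → sideLength (frame t (s , a)) (frame t (s , b)) ≡ (a - b) * (a - b) * κ t
  sideLength-column t s a b = trans (cong (λ v → v · v) (frame-side-column t s a b)) (length² t (a - b))
    where
    length² : ∀ t d → - (t * d) * - (t * d) + d * d ≡ d * d * κ t
    length² = solve 2 (λ t d → ⊝ (t ⊗ d) ⊗ ⊝ (t ⊗ d) ⊕ d ⊗ d ⊜ d ⊗ d ⊗ (Κ (+ 1) ⊕ t ⊗ t)) refl

  rightAt-column-row : ∀ t a b c d → RightAt (frame t (a , d)) (frame t (a , b)) (frame t (c , b))
  rightAt-column-row t a b c d =
    trans (cong₂ _·_ (frame-side-column t a d b) (frame-side-row t c a b)) (orthogonal t (d - b) (c - a))
    where
    orthogonal : ∀ t e f → - (t * e) * f + e * (t * f) ≡ 0#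
    orthogonal = solve 3 (λ t e f → ⊝ (t ⊗ e) ⊗ f ⊕ e ⊗ (t ⊗ f) ⊜ Κ (+ 0)) refl

  rightAt-row-column : ∀ t a b c d → RightAt (frame t (c , b)) (frame t (a , b)) (frame t (a , d))
  rightAt-row-column t a b c d =
    trans (cong₂ _·_ (frame-side-row t c a b) (frame-side-column t a d b)) (orthogonal t (c - a) (d - b))
    where
    orthogonal : ∀ t f e → f * - (t * e) + t * f * e ≡ 0#
    orthogonal = solve 3 (λ t f e → f ⊗ ⊝ (t ⊗ e) ⊕ t ⊗ f ⊗ e ⊜ Κ (+ 0)) refl

  module _ {t} (κ≢0 : κ t ≢ 0#) where

    private
      κ⁻¹ : Fin q
      κ⁻¹ = proj₁ (inverse (κ t) κ≢0)

      κκ⁻¹ : κ t * κ⁻¹ ≡ 1#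
      κκ⁻¹ = proj₂ (inverse (κ t) κ≢0)

      unframe : Point → Point
      unframe (a , b) = (κ⁻¹ * (a + t * b) , κ⁻¹ * (b - t * a))

      scale-by-1 : ∀ x → κ t * κ⁻¹ * x ≡ x
      scale-by-1 x = trans (cong (_* x) κκ⁻¹) (*-identityˡ x)

    frame-unframe : ∀ u → frame t (unframe u) ≡ u
    frame-unframe (a , b) = cong₂ _,_ (trans (first t κ⁻¹ a b) (scale-by-1 a)) (trans (second t κ⁻¹ a b) (scale-by-1 b))
      where
      first : ∀ t k a b → k * (a + t * b) - t * (k * (b - t * a)) ≡ κ t * k * a
      first = solve 4 (λ t k a b → k ⊗ (a ⊕ t ⊗ b) ⊕ ⊝ (t ⊗ (k ⊗ (b ⊕ ⊝ (t ⊗ a)))) ⊜ (Κ (+ 1) ⊕ t ⊗ t) ⊗ k ⊗ a) refl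
      second : ∀ t k a b → k * (b - t * a) + t * (k * (a + t * b)) ≡ κ t * k * b
      second = solve 4 (λ t k a b → k ⊗ (b ⊕ ⊝ (t ⊗ a)) ⊕ t ⊗ (k ⊗ (a ⊕ t ⊗ b)) ⊜ (Κ (+ 1) ⊕ t ⊗ t) ⊗ k ⊗ b) refl

    unframe-frame : ∀ p → unframe (frame t p) ≡ p
    unframe-frame (s , r) = cong₂ _,_ (trans (first t κ⁻¹ s r) (scale-by-1 s)) (trans (second t κ⁻¹ s r) (scale-by-1 r))
      where
      first : ∀ t k s r → k * ((s - t * r) + t * (r + t * s)) ≡ κ t * k * s
      first = solve 4 (λ t k s r → k ⊗ ((s ⊕ ⊝ (t ⊗ r)) ⊕ t ⊗ (r ⊕ t ⊗ s)) ⊜ (Κ (+ 1) ⊕ t ⊗ t) ⊗ k ⊗ s) refl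
      second : ∀ t k s r → k * ((r + t * s) - t * (s - t * r)) ≡ κ t * k * r
      second = solve 4 (λ t k s r → k ⊗ ((r ⊕ t ⊗ s) ⊕ ⊝ (t ⊗ (s ⊕ ⊝ (t ⊗ r)))) ⊜ (Κ (+ 1) ⊕ t ⊗ t) ⊗ k ⊗ r) refl

    frame-injective : ∀ {p p′} → frame t p ≡ frame t p′ → p ≡ p′
    frame-injective {p} {p′} eq = trans (sym (unframe-frame p)) (trans (cong unframe eq) (unframe-frame p′))

    ∑-frame : (f : Point → ℕ) → ∑ Plane f ≡ ∑[ p ∈ Plane ] f (frame t p)
    ∑-frame = ∑-bijection Plane Plane (frame t) unframe frame-unframe unframe-frame

  open Grid (fin q) (fin q) using (□; apart?)

  gridRectangle : Fin q → El □ → Quad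
  gridRectangle t (s , r , s′ , r′) = frame t (s , r) , frame t (s′ , r) , frame t (s′ , r′) , frame t (s , r′)

  Parameters : Shape
  Parameters = fin q ⊗ □

  Admissible : El Parameters → Set
  Admissible (t , s , r , s′ , r′) = κ t ≢ 0# × s′ ≢ s × r′ ≢ r

  admissible? : ∀ p → Dec (Admissible p)
  admissible? (t , s , r , s′ , r′) = nonIsotropic? t ×-dec apart? s r s′ r′

  rectangle : El Parameters → Quad
  rectangle (t , x) = gridRectangle t x

  rectangle-good : ∀ p → Admissible p → GoodRectangle (rectangle p)
  rectangle-good (t , s , r , s′ , r′) (κ≢0 , s′≢s , r′≢r) =
    ( rightAt-column-row t s r s′ r′ , rightAt-row-column t s′ r s r′
    , rightAt-column-row t s′ r′ s r , rightAt-row-column t s r′ s′ r )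
    , nonzero (sideLength-row t s s′ r) (s′≢s ∘ sym) , nonzero (sideLength-column t s′ r r′) (r′≢r ∘ sym)
    , nonzero (sideLength-row t s′ s r′) s′≢s , nonzero (sideLength-column t s r′ r) r′≢r
    where
    nonzero : ∀ {ℓ a b} → ℓ ≡ (a - b) * (a - b) * κ t → a ≢ b → ℓ ≢ 0#
    nonzero ℓ≡ a≢b ℓ≡0 = *-nonzero (*-nonzero (x-y≢0 a≢b) (x-y≢0 a≢b)) κ≢0 (trans (sym ℓ≡) ℓ≡0)

  -- The first side (s′ - s) (1 , t) determines the slope, and then frame t is invertible.
  rectangle-injective : ∀ {p p′} → Admissible p → Admissible p′ → rectangle p ≡ rectangle p′ → p ≡ p′
  rectangle-injective {t , s , r , s′ , r′} {t₁ , s₁ , r₁ , s₁′ , r₁′} (κ≢0 , s′≢s , _) _ eq =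
    cong₂ _,_ t≡t₁ (cong₂ _,_ (cong proj₁ sr) (cong₂ _,_ (cong proj₂ sr) (cong₂ _,_ (cong proj₁ s′r) (cong proj₂ sr′))))
    where
    first-side : (s′ - s , t * (s′ - s)) ≡ (s₁′ - s₁ , t₁ * (s₁′ - s₁))
    first-side = trans (sym (frame-side-row t s′ s r))
                   (trans (cong₂ _−_ (cong (proj₁ ∘ proj₂) eq) (cong proj₁ eq)) (frame-side-row t₁ s₁′ s₁ r₁))
    t≡t₁ : t ≡ t₁
    t≡t₁ = *-cancelˡ t t₁ (x-y≢0 s′≢s) (trans (*-comm (s′ - s) t)
             (trans (cong proj₂ first-side) (trans (cong (t₁ *_) (sym (cong proj₁ first-side))) (*-comm t₁ (s′ - s)))))
    same-frame : ∀ {x y} → frame t x ≡ frame t₁ y → x ≡ y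
    same-frame {x} {y} e = frame-injective κ≢0 (trans e (cong (λ τ → frame τ y) (sym t≡t₁)))
    sr : (s , r) ≡ (s₁ , r₁)
    sr = same-frame (cong proj₁ eq)
    s′r : (s′ , r) ≡ (s₁′ , r₁)
    s′r = same-frame (cong (proj₁ ∘ proj₂) eq)
    sr′ : (s , r′) ≡ (s₁ , r₁′)
    sr′ = same-frame (cong (proj₂ ∘ proj₂ ∘ proj₂) eq)

  q≤slopes+2 : q ℕ.≤ ∑[ t ∈ fin q ] 𝟙 (nonIsotropic? t) ℕ.+ 2
  q≤slopes+2 = begin
    q                                                                  ≡⟨ ℕ.*-identityʳ q ⟨
    q ℕ.* 1                                                            ≡⟨ ∑-const (fin q) 1 ⟨
    ∑[ t ∈ fin q ] 1                                                   ≡⟨ ∑-cong (fin q) split ⟨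
    ∑[ t ∈ fin q ] (𝟙 (nonIsotropic? t) ℕ.+ 𝟙 (t * t ≟ - 1#))            ≡⟨ ∑-distrib-+ (fin q) _ _ ⟩
    ∑[ t ∈ fin q ] 𝟙 (nonIsotropic? t) ℕ.+ ∑[ t ∈ fin q ] 𝟙 (t * t ≟ - 1#)
      ≤⟨ ℕ.+-monoʳ-≤ _ (at-most-two-square-roots (- 1#)) ⟩
    ∑[ t ∈ fin q ] 𝟙 (nonIsotropic? t) ℕ.+ 2                             ∎
    where
    open ℕ.≤-Reasoning
    split : ∀ t → 𝟙 (nonIsotropic? t) ℕ.+ 𝟙 (t * t ≟ - 1#) ≡ 1
    split t = trans (cong (𝟙 (nonIsotropic? t) ℕ.+_) (𝟙-cong (t * t ≟ - 1#) (κ t ≟ 0#) to from)) (𝟙-¬?-+ (κ t ≟ 0#))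
      where
      to : t * t ≡ - 1# → κ t ≡ 0#
      to eq = trans (cong (λ x → 1# + x) eq) (-‿inverseʳ 1#)
      from : κ t ≡ 0# → t * t ≡ - 1#
      from eq = trans (shift t) (trans (cong (_- 1#) eq) (+-identityˡ (- 1#)))
        where
        shift : ∀ t → t * t ≡ κ t - 1#
        shift = solve 1 (λ t → t ⊗ t ⊜ (Κ (+ 1) ⊕ t ⊗ t) ⊕ ⊝ Κ (+ 1)) refl

module Counting {q : ℕ} (F : FiniteField q) (S : Geometry.Subset² F) where

  open import Data.Nat.Base
  open import Data.Nat.Properties
  open import Data.Nat.Tactic.RingSolver using (solve-∀)
  open import Data.Fin.Base using (Fin)
  open import Data.Bool.Base using (true)
  import Data.Bool
  open import Data.Product.Base using (_,_)
  open import Function.Base using (_∘_)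
  open import Relation.Nullary using (yes; no)
  open import Relation.Binary.PropositionalEquality
  open FiniteField F using (0#)
  open Geometry F
  open Rectangles F
  open Grid (fin q) (fin q) using (□; apart?)
  open Arithmetic

  Quadrilaterals : Shape
  Quadrilaterals = Plane ⊗ (Plane ⊗ (Plane ⊗ Plane))

  inS : Point → ℕ
  inS u = 𝟙 (S u Data.Bool.≟ true)

  inS⁴ : Quad → ℕ
  inS⁴ (u₁ , u₂ , u₃ , u₄) = inS u₁ * (inS u₂ * (inS u₃ * inS u₄))

  goodInS : Quad → ℕ
  goodInS Q = inS⁴ Q * 𝟙 (goodRectangle? Q)

  card≡∑ : card S ≡ ∑ Plane inS
  card≡∑ = trans (length≡∑ˡ-𝟙 _ allPoints) (∑ˡ-enumerate Plane inS)

  rectangleCount≡∑ : rectangleCount S ≡ ∑ Quadrilaterals goodInS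
  rectangleCount≡∑ = trans (length≡∑ˡ-𝟙 goodRectangle? (quads S)) (∑ˡ≡∑ quads-enumerates (𝟙 ∘ goodRectangle?))
    where
    elems-enumerates : Enumerates Plane inS (elems S)
    elems-enumerates = filter-enumerate Plane (λ u → S u Data.Bool.≟ true)
    quads-enumerates : Enumerates Quadrilaterals inS⁴ (quads S)
    quads-enumerates = cartesianProduct-enumerates Plane _ elems-enumerates
                         (cartesianProduct-enumerates Plane _ elems-enumerates
                           (cartesianProduct-enumerates Plane Plane elems-enumerates elems-enumerates))

  module Slope (t : Fin q) = Grid.PointSet (fin q) (fin q) (λ s r → S (frame t (s , r)) Data.Bool.≟ true)
  open Slope using (rectangles)

  ∑-slopes≤rectangleCount : ∑[ t ∈ fin q ] (𝟙 (nonIsotropic? t) * rectangles t) ≤ rectangleCount S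
  ∑-slopes≤rectangleCount = begin
    ∑[ t ∈ fin q ] (𝟙 (nonIsotropic? t) * rectangles t)
      ≡⟨ ∑-cong (fin q) (λ t → *-distribˡ-∑ □ (𝟙 (nonIsotropic? t)) _) ⟩
    ∑ Parameters (λ (t , s , r , s′ , r′) →
                    𝟙 (nonIsotropic? t) * (𝟙 (apart? s r s′ r′) * inS⁴ (gridRectangle t (s , r , s′ , r′))))
      ≡⟨ ∑-cong Parameters (λ (t , s , r , s′ , r′) →
           let corners = inS⁴ (gridRectangle t (s , r , s′ , r′)) in
           trans (sym (*-assoc (𝟙 (nonIsotropic? t)) (𝟙 (apart? s r s′ r′)) corners))
                 (cong (_* corners) (sym (𝟙-× (nonIsotropic? t) (apart? s r s′ r′))))) ⟩
    ∑[ p ∈ Parameters ] (𝟙 (admissible? p) * inS⁴ (rectangle p))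
      ≡⟨ ∑-cong Parameters only-good ⟩
    ∑[ p ∈ Parameters ] (𝟙 (admissible? p) * goodInS (rectangle p))
      ≤⟨ ∑-injection Parameters Quadrilaterals admissible? rectangle rectangle-injective goodInS ⟩
    ∑ Quadrilaterals goodInS
      ≡⟨ rectangleCount≡∑ ⟨
    rectangleCount S ∎
    where
    open ≤-Reasoning
    only-good : ∀ p → 𝟙 (admissible? p) * inS⁴ (rectangle p) ≡ 𝟙 (admissible? p) * goodInS (rectangle p)
    only-good p with admissible? p
    ... | no _  = refl
    ... | yes a = cong (1 *_) (sym (trans (cong (inS⁴ (rectangle p) *_) good) (*-identityʳ _)))
      where good = 𝟙-yes (goodRectangle? (rectangle p)) (rectangle-good p a)

  private
    N R : ℕ
    N = card S
    R = rectangleCount S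

  card⁴≤ : ∀ {t} → κ t ≢ 0# → N ^ 4 ≤ q ^ 4 * (rectangles t + 2 * q * N)
  card⁴≤ {t} κ≢0 = begin
    N ^ 4                                               ≡⟨ fourth-power N ⟩
    N * N * (N * N)                                     ≡⟨ cong (λ n → n * n * (n * n)) size≡N ⟨
    size * size * (size * size)                         ≤⟨ Slope.size⁴≤ t ⟩
    q * q * (q * q) * (rectangles t + (q + q) * size)
      ≡⟨ cong (λ n → q * q * (q * q) * (rectangles t + (q + q) * n)) size≡N ⟩
    q * q * (q * q) * (rectangles t + (q + q) * N)      ≡⟨ regroup q (rectangles t) N ⟩
    q ^ 4 * (rectangles t + 2 * q * N)                  ∎
    where
    open ≤-Reasoning
    open Slope t using (size)
    size≡N : size ≡ N
    size≡N = sym (trans card≡∑ (∑-frame κ≢0 inS))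
    fourth-power : ∀ n → n * (n * (n * (n * 1))) ≡ n * n * (n * n)
    fourth-power = solve-∀
    regroup : ∀ q r n → q * q * (q * q) * (r + (q + q) * n) ≡ q * (q * (q * (q * 1))) * (r + 2 * q * n)
    regroup = solve-∀

  card⁴≤2q⁴·rectangles : 4 * q ^ 5 ≤ N ^ 3 → ∀ {t} → κ t ≢ 0# → N ^ 4 ≤ 2 * q ^ 4 * rectangles t
  card⁴≤2q⁴·rectangles dense {t} κ≢0 = begin
    N ^ 4                      ≤⟨ m≤n+o∧2o≤m⇒m≤2n (q ^ 4 * rectangles t) (q ^ 4 * (2 * q * N)) split degenerate ⟩
    2 * (q ^ 4 * rectangles t) ≡⟨ *-assoc 2 (q ^ 4) (rectangles t) ⟨
    2 * q ^ 4 * rectangles t   ∎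
    where
    open ≤-Reasoning
    split : N ^ 4 ≤ q ^ 4 * rectangles t + q ^ 4 * (2 * q * N)
    split = ≤-trans (card⁴≤ κ≢0) (≤-reflexive (*-distribˡ-+ (q ^ 4) (rectangles t) (2 * q * N)))
    degenerate : 2 * (q ^ 4 * (2 * q * N)) ≤ N ^ 4
    degenerate = begin
      2 * (q ^ 4 * (2 * q * N)) ≡⟨ expand q N ⟩
      4 * q ^ 5 * N             ≤⟨ *-monoˡ-≤ N dense ⟩
      N ^ 3 * N                 ≡⟨ *-comm (N ^ 3) N ⟩
      N ^ 4                     ∎
      where
      expand : ∀ q n → 2 * (q * (q * (q * (q * 1))) * (2 * q * n)) ≡ 4 * (q * (q * (q * (q * (q * 1))))) * n
      expand = solve-∀

  slopes*card⁴≤ : 4 * q ^ 5 ≤ N ^ 3 → (∑[ t ∈ fin q ] 𝟙 (nonIsotropic? t)) * N ^ 4 ≤ 2 * q ^ 4 * R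
  slopes*card⁴≤ dense = begin
    (∑[ t ∈ fin q ] 𝟙 (nonIsotropic? t)) * N ^ 4                      ≡⟨ *-distribʳ-∑ (fin q) (N ^ 4) _ ⟩
    ∑[ t ∈ fin q ] (𝟙 (nonIsotropic? t) * N ^ 4)                      ≤⟨ ∑-mono-≤ (fin q) one-slope ⟩
    ∑[ t ∈ fin q ] (2 * q ^ 4 * (𝟙 (nonIsotropic? t) * rectangles t)) ≡⟨ *-distribˡ-∑ (fin q) (2 * q ^ 4) _ ⟨
    2 * q ^ 4 * ∑[ t ∈ fin q ] (𝟙 (nonIsotropic? t) * rectangles t)
      ≤⟨ *-monoʳ-≤ (2 * q ^ 4) ∑-slopes≤rectangleCount ⟩
    2 * q ^ 4 * R                                                     ∎
    where
    open ≤-Reasoning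
    one-slope : ∀ t → 𝟙 (nonIsotropic? t) * N ^ 4 ≤ 2 * q ^ 4 * (𝟙 (nonIsotropic? t) * rectangles t)
    one-slope t with nonIsotropic? t
    ... | no _    = z≤n
    ... | yes κ≢0 = subst₂ _≤_ (sym (*-identityˡ (N ^ 4))) (cong (2 * q ^ 4 *_) (sym (*-identityˡ (rectangles t))))
                           (card⁴≤2q⁴·rectangles dense κ≢0)

  card⁴≤6·count·q³ : 3 ≤ q → 4 * q ^ 5 ≤ N ^ 3 → N ^ 4 ≤ 6 * R * q ^ 3
  card⁴≤6·count·q³ 3≤q dense = *-cancelˡ-≤ q ⦃ >-nonZero (≤-trans (s≤s z≤n) 3≤q) ⦄ (begin
    q * N ^ 4               ≤⟨ *-monoˡ-≤ (N ^ 4) (n≤m+2⇒n≤3m 3≤q q≤slopes+2) ⟩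
    3 * slopes * N ^ 4      ≡⟨ *-assoc 3 slopes (N ^ 4) ⟩
    3 * (slopes * N ^ 4)    ≤⟨ *-monoʳ-≤ 3 (slopes*card⁴≤ dense) ⟩
    3 * (2 * q ^ 4 * R)     ≡⟨ rearrange q R ⟩
    q * (6 * R * q ^ 3)     ∎)
    where
    open ≤-Reasoning
    slopes = ∑[ t ∈ fin q ] 𝟙 (nonIsotropic? t)
    rearrange : ∀ q r → 3 * (2 * (q * (q * (q * (q * 1)))) * r) ≡ q * (6 * r * (q * (q * (q * 1))))
    rearrange = solve-∀

open import Data.Nat using (ℕ; suc; _*_; _^_; _≤_; _≥_; _%_; s≤s; z≤n)
open import Data.Product using (∃-syntax; _,_)
open import Relation.Binary.PropositionalEquality using (_≡_)

-- In the paper q ≡ 3 (mod 4) makes every slope non-isotropic; here at most two slopes are isotropic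
-- anyway.
3≤q : ∀ q → q % 4 ≡ 3 → 3 ≤ q
3≤q (suc (suc (suc q))) _ = s≤s (s≤s (s≤s z≤n))

lemma2p3 : ∃[ C ] ∃[ K ] ((q : ℕ) → IsPrimePower q → q % 4 ≡ 3 →
             (F : FiniteField q) → (S : Geometry.Subset² F) →
             Geometry.card F S ^ 3 ≥ C * q ^ 5 →
             K * Geometry.rectangleCount F S * q ^ 3 ≥ Geometry.card F S ^ 4)
lemma2p3 = 4 , 6 , λ q _ q%4≡3 F S dense → Counting.card⁴≤6·count·q³ F S (3≤q q q%4≡3) dense
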